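{- For every set of formulas $\Gamma\cup\{\alpha\}$: if $\Gamma\vdash_{L_1^1}\alpha$, then $\Gamma\vDash_{\mathcal{M}_1^1}\alpha$.
   Context: Formulas are built from propositional variables using unary $\neg,\circ$ and binary $\land,\lor,\to$; $\circ^{m+1}\alpha=\circ\circ^m\alpha$. Logics are Hilbert calculi with modus ponens as only rule and axiom schemas. mbC has the positive classical axioms $\alpha\to(\beta\to\alpha)$; $(\alpha\to\beta)\to((\alpha\to(\beta\to\gamma))\to(\alpha\to\gamma))$; $\alpha\to(\beta\to(\alpha\land\beta))$; $(\alpha\land\beta)\to\alpha$; $(\alpha\land\beta)\to\beta$; $\alpha\to(\alpha\lor\beta)$; $\beta\to(\alpha\lor\beta)$; $(\alpha\to\gamma)\to((\beta\to\gamma)\to((\alpha\lor\beta)\to\gamma))$; $\alpha\lor(\alpha\to\beta)$; plus $\alpha\lor\neg\alpha$ and $\circ\alpha\to(\alpha\to(\neg\alpha\to\beta))$. mbCciw = mbC + $\circ\alpha\lor(\alpha\land\neg\alpha)$. $L_1^0$ = mbCciw + $\circ\circ\circ\alpha$. $L_1^1$ = $L_1^0$ + (cf) $\neg\neg\alpha\to\alpha$ + (ce) $\alpha\to\neg\neg\alpha$. Nmatrix semantics: a valuation is a map $v$ from formulas into the domain with $v(\neg\alpha)\in\neg v(\alpha)$, $v(\circ\alpha)\in\circ v(\alpha)$, $v(\alpha\#\beta)\in v(\alpha)\#v(\beta)$; $\Gamma\vDash\alpha$ iff every valuation designating all of $\Gamma$ designates $\alpha$. $\mathcal{M}_1^1$: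 with Boolean $\land,\lor,\to,\sim$ on $\{0,1\}$, domain $\mathbb{B}_1^0=\{x\in\{0,1\}^3: x_1\lor x_2=1,\ x_3\lor\sim(x_1\land x_2)=1\}$; $x\#y=\{z\in\mathbb{B}_1^0: z_1=x_1\#y_1\}$ for $\#\in\{\land,\lor,\to\}$; $\neg x=\{z\in\mathbb{B}_1^0:z_1=x_2\text{ and }z_2=x_1\}$; $\circ x=\{(\sim(x_1\land x_2),\,x_3,\,x_3\land\sim(x_1\land x_2))\}$; designated set $\{x\in\mathbb{B}_1^0:x_1=1\}$. -}

module Defs where

open import Data.Nat using (ℕ)
open import Data.Bool using (Bool; true; false; _∧_; _∨_; not)
open import Data.Product using (_×_; _,_)
open import Relation.Binary.PropositionalEquality using (_≡_)

infixr 20 _⇒_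
infixl 22 _∨'_
infixl 24 _∧'_

data Formula : Set where
  var  : ℕ → Formula
  ¬'_  : Formula → Formula
  ∘'_  : Formula → Formula
  _∧'_ : Formula → Formula → Formula
  _∨'_ : Formula → Formula → Formula
  _⇒_  : Formula → Formula → Formula

FSet : Set₁
FSet = Formula → Set

-- Hilbert calculus L₁¹ (axiom schemas of mbC, ciw, ∘∘∘α, cf, ce)

data AxL11 : Formula → Set where
  ax1  : ∀ a b → AxL11 (a ⇒ (b ⇒ a))
  ax2  : ∀ a b c → AxL11 ((a ⇒ b) ⇒ ((a ⇒ (b ⇒ c)) ⇒ (a ⇒ c)))
  ax3  : ∀ a b → AxL11 (a ⇒ (b ⇒ (a ∧' b)))
  ax4  : ∀ a b → AxL11 ((a ∧' b) ⇒ a)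
  ax5  : ∀ a b → AxL11 ((a ∧' b) ⇒ b)
  ax6  : ∀ a b → AxL11 (a ⇒ (a ∨' b))
  ax7  : ∀ a b → AxL11 (b ⇒ (a ∨' b))
  ax8  : ∀ a b c → AxL11 ((a ⇒ c) ⇒ ((b ⇒ c) ⇒ ((a ∨' b) ⇒ c)))
  ax9  : ∀ a b → AxL11 (a ∨' (a ⇒ b))
  ax10 : ∀ a → AxL11 (a ∨' (¬' a))
  bc1  : ∀ a b → AxL11 ((∘' a) ⇒ (a ⇒ ((¬' a) ⇒ b)))
  ciw  : ∀ a → AxL11 ((∘' a) ∨' (a ∧' (¬' a)))
  ooo  : ∀ a → AxL11 (∘' (∘' (∘' a)))
  cf   : ∀ a → AxL11 ((¬' (¬' a)) ⇒ a)
  ce   : ∀ a → AxL11 (a ⇒ (¬' (¬' a)))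

data _⊢_ (Γ : FSet) : Formula → Set where
  hyp : ∀ {a} → Γ a → Γ ⊢ a
  ax  : ∀ {a} → AxL11 a → Γ ⊢ a
  mp  : ∀ {a b} → Γ ⊢ a → Γ ⊢ (a ⇒ b) → Γ ⊢ b

record 𝔹 : Set where
  constructor mk
  field
    x₁ x₂ x₃ : Bool
    c₁ : (x₁ ∨ x₂) ≡ true
    c₂ : (x₃ ∨ not (x₁ ∧ x₂)) ≡ true
open 𝔹 public

_⇒ᵇ_ : Bool → Bool → Bool
a ⇒ᵇ b = not a ∨ b

-- Multioperations as relations: "z ∈ op x y"
_∈∧_ : 𝔹 → 𝔹 × 𝔹 → Set
z ∈∧ (x , y) = x₁ z ≡ (x₁ x ∧ x₁ y)

_∈∨_ : 𝔹 → 𝔹 × 𝔹 → Set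
z ∈∨ (x , y) = x₁ z ≡ (x₁ x ∨ x₁ y)

_∈⇒_ : 𝔹 → 𝔹 × 𝔹 → Set
z ∈⇒ (x , y) = x₁ z ≡ (x₁ x ⇒ᵇ x₁ y)

_∈¬_ : 𝔹 → 𝔹 → Set
z ∈¬ x = (x₁ z ≡ x₂ x) × (x₂ z ≡ x₁ x)

_∈∘_ : 𝔹 → 𝔹 → Set
z ∈∘ x = (x₁ z ≡ not (x₁ x ∧ x₂ x))
       × (x₂ z ≡ x₃ x)
       × (x₃ z ≡ (x₃ x ∧ not (x₁ x ∧ x₂ x)))

Designated : 𝔹 → Set
Designated x = x₁ x ≡ true

record IsValuation (v : Formula → 𝔹) : Set where
  field
    v¬ : ∀ a → v (¬' a) ∈¬ v a
    v∘ : ∀ a → v (∘' a) ∈∘ v a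
    v∧ : ∀ a b → v (a ∧' b) ∈∧ (v a , v b)
    v∨ : ∀ a b → v (a ∨' b) ∈∨ (v a , v b)
    v⇒ : ∀ a b → v (a ⇒ b) ∈⇒ (v a , v b)

_⊨_ : FSet → Formula → Set
Γ ⊨ α = (v : Formula → 𝔹) → IsValuation v →
        (∀ γ → Γ γ → Designated (v γ)) → Designated (v α)

{-# OPTIONS --safe #-}
module Submission where

open import Defs
open import Data.Bool using (true; false; _∧_; _∨_; not; _≟_)
open import Data.Bool.Properties using (∧-comm; ∧-conicalˡ; ∧-conicalʳ; ∨-zeroʳ; not-¬)
open import Data.Empty using (⊥-elim)
open import Data.Product using (_×_; _,_; proj₁; proj₂; map₂)
open import Data.Sum using (_⊎_; inj₁; inj₂; [_,_]′)
open import Function using (_∘_)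
open import Relation.Nullary using (¬_; Dec; yes; no)
open import Relation.Nullary.Decidable using (_×-dec_)
open import Relation.Binary.PropositionalEquality using (_≡_; refl; sym; trans; cong; cong₂; module ≡-Reasoning)

-- Designation under a valuation behaves classically: a ⇒ b, a ∧ b, a ∨ b are
-- designated iff the corresponding meta-level statement about a and b holds,
-- ¬ a is designated iff x₂ (v a) is set, and ∘ a is designated iff a and ¬ a
-- are not both designated.  So each axiom is designated by the meta-level
-- proof of the tautology it expresses.  For ∘∘∘a: in every y ∈ ∘ x the third
-- coordinate is x₁ y ∧ x₂ y, so every z ∈ ∘ y has x₂ z = not (x₁ z), i.e. ∘∘a
-- is never contradictory, whence ∘∘∘a is designated.

⇒ᵇ-intro : ∀ x {y} → (x ≡ true → y ≡ true) → (x ⇒ᵇ y) ≡ true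
⇒ᵇ-intro false f = refl
⇒ᵇ-intro true  f = f refl

⇒ᵇ-elim : ∀ {x y} → (x ⇒ᵇ y) ≡ true → x ≡ true → y ≡ true
⇒ᵇ-elim h refl = h

∨ᵇ-elim : ∀ x {y} → (x ∨ y) ≡ true → x ≡ true ⊎ y ≡ true
∨ᵇ-elim true  _ = inj₁ refl
∨ᵇ-elim false h = inj₂ h

nandᵇ-intro : ∀ x y → ¬ (x ≡ true × y ≡ true) → not (x ∧ y) ≡ true
nandᵇ-intro false y     _ = refl
nandᵇ-intro true  false _ = refl
nandᵇ-intro true  true  h = ⊥-elim (h (refl , refl))

nandᵇ-elim : ∀ x y → not (x ∧ y) ≡ true → ¬ (x ≡ true × y ≡ true)
nandᵇ-elim true true () (refl , refl)

designated? : ∀ x → Dec (Designated x)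
designated? x = x₁ x ≟ true

∘-x₃ : ∀ x y → y ∈∘ x → x₃ y ≡ (x₁ y ∧ x₂ y)
∘-x₃ x y (e₁ , e₂ , e₃) = begin
  x₃ y                          ≡⟨ e₃ ⟩
  x₃ x ∧ not (x₁ x ∧ x₂ x)      ≡⟨ ∧-comm (x₃ x) _ ⟩
  not (x₁ x ∧ x₂ x) ∧ x₃ x      ≡⟨ sym (cong₂ _∧_ e₁ e₂) ⟩
  x₁ y ∧ x₂ y                   ∎
  where open ≡-Reasoning

∘∘-consistent : ∀ x y z → y ∈∘ x → z ∈∘ y → ¬ (x₁ z ≡ true × x₂ z ≡ true)
∘∘-consistent x y z y∈∘x (e₁ , e₂ , _) (d₁ , d₂) = not-¬ (sym both) (sym nand)
  where
  both : (x₁ y ∧ x₂ y) ≡ true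
  both = trans (sym (trans e₂ (∘-x₃ x y y∈∘x))) d₂
  nand : not (x₁ y ∧ x₂ y) ≡ true
  nand = trans (sym e₁) d₁

module _ {v : Formula → 𝔹} (V : IsValuation v) where
  open IsValuation V

  D : Formula → Set
  D a = Designated (v a)

  ⇒-intro : ∀ {a b} → (D a → D b) → D (a ⇒ b)
  ⇒-intro {a} {b} f = trans (v⇒ a b) (⇒ᵇ-intro (x₁ (v a)) f)

  ⇒-elim : ∀ {a b} → D (a ⇒ b) → D a → D b
  ⇒-elim {a} {b} d = ⇒ᵇ-elim (trans (sym (v⇒ a b)) d)

  ∧-intro : ∀ {a b} → D a → D b → D (a ∧' b)
  ∧-intro {a} {b} da db = trans (v∧ a b) (cong₂ _∧_ da db)

  ∧-elimˡ : ∀ {a b} → D (a ∧' b) → D a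
  ∧-elimˡ {a} {b} d = ∧-conicalˡ _ _ (trans (sym (v∧ a b)) d)

  ∧-elimʳ : ∀ {a b} → D (a ∧' b) → D b
  ∧-elimʳ {a} {b} d = ∧-conicalʳ _ _ (trans (sym (v∧ a b)) d)

  ∨-introˡ : ∀ {a b} → D a → D (a ∨' b)
  ∨-introˡ {a} {b} d = trans (v∨ a b) (cong (_∨ x₁ (v b)) d)

  ∨-introʳ : ∀ {a b} → D b → D (a ∨' b)
  ∨-introʳ {a} {b} d = trans (v∨ a b) (trans (cong (x₁ (v a) ∨_) d) (∨-zeroʳ _))

  ∨-elim : ∀ {a b} → D (a ∨' b) → D a ⊎ D b
  ∨-elim {a} {b} d = ∨ᵇ-elim _ (trans (sym (v∨ a b)) d)

  ¬-intro : ∀ {a} → x₂ (v a) ≡ true → D (¬' a)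
  ¬-intro {a} = trans (proj₁ (v¬ a))

  ¬-elim : ∀ {a} → D (¬' a) → x₂ (v a) ≡ true
  ¬-elim {a} = trans (sym (proj₁ (v¬ a)))

  ¬¬-x₁ : ∀ a → x₁ (v (¬' ¬' a)) ≡ x₁ (v a)
  ¬¬-x₁ a = trans (proj₁ (v¬ (¬' a))) (proj₂ (v¬ a))

  ∘-intro : ∀ {a} → ¬ (D a × D (¬' a)) → D (∘' a)
  ∘-intro {a} h = trans (proj₁ (v∘ a)) (nandᵇ-intro _ _ (h ∘ map₂ ¬-intro))

  ∘-elim : ∀ {a} → D (∘' a) → ¬ (D a × D (¬' a))
  ∘-elim {a} d = nandᵇ-elim _ _ (trans (sym (proj₁ (v∘ a))) d) ∘ map₂ ¬-elim

  axiom-designated : ∀ {a} → AxL11 a → D a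
  axiom-designated (ax1 a b) = ⇒-intro λ da → ⇒-intro λ _ → da
  axiom-designated (ax2 a b c) =
    ⇒-intro λ ab → ⇒-intro λ abc → ⇒-intro λ da → ⇒-elim (⇒-elim abc da) (⇒-elim ab da)
  axiom-designated (ax3 a b) = ⇒-intro λ da → ⇒-intro λ db → ∧-intro da db
  axiom-designated (ax4 a b) = ⇒-intro ∧-elimˡ
  axiom-designated (ax5 a b) = ⇒-intro ∧-elimʳ
  axiom-designated (ax6 a b) = ⇒-intro ∨-introˡ
  axiom-designated (ax7 a b) = ⇒-intro ∨-introʳ
  axiom-designated (ax8 a b c) =
    ⇒-intro λ ac → ⇒-intro λ bc → ⇒-intro λ d → [ ⇒-elim ac , ⇒-elim bc ]′ (∨-elim d)
  axiom-designated (ax9 a b) with designated? (v a)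
  ... | yes da = ∨-introˡ da
  ... | no ¬da = ∨-introʳ (⇒-intro (⊥-elim ∘ ¬da))
  axiom-designated (ax10 a) = [ ∨-introˡ , ∨-introʳ ∘ ¬-intro ]′ (∨ᵇ-elim _ (c₁ (v a)))
  axiom-designated (bc1 a b) =
    ⇒-intro λ o → ⇒-intro λ da → ⇒-intro λ dn → ⊥-elim (∘-elim o (da , dn))
  axiom-designated (ciw a) with designated? (v a) ×-dec designated? (v (¬' a))
  ... | yes (da , dn) = ∨-introʳ (∧-intro da dn)
  ... | no ¬both      = ∨-introˡ (∘-intro ¬both)
  axiom-designated (ooo a) =
    ∘-intro (∘∘-consistent (v a) (v (∘' a)) (v (∘' ∘' a)) (v∘ a) (v∘ (∘' a)) ∘ map₂ ¬-elim)
  axiom-designated (cf a) = ⇒-intro (trans (sym (¬¬-x₁ a)))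
  axiom-designated (ce a) = ⇒-intro (trans (¬¬-x₁ a))

theorem7 : (Γ : FSet) (α : Formula) → Γ ⊢ α → Γ ⊨ α
theorem7 Γ α (hyp γ)  v V DΓ = DΓ α γ
theorem7 Γ α (ax A)   v V DΓ = axiom-designated V A
theorem7 Γ α (mp d e) v V DΓ = ⇒-elim V (theorem7 Γ _ e v V DΓ) (theorem7 Γ _ d v V DΓ)
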